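{- Let $a>1$ and $b>1$ be relatively prime integers, and define $\sigma$ as follows: for each of the distinct prime divisors $p_1,\dots,p_m$ of $a$, let $n_i$ be the least positive integer for which there is a positive integer $k$ with $|b^{n_i}-kp_i|=1$, let $g_i$ be the exponent with $p_i^{g_i}\,\|\,b^{n_i}\pm1$ where the sign is chosen to maximize $g_i$, and set $\sigma=\sum_i g_i\log(p_i)/\log(a)$. If $a>2$ and $(a,b)\ne(3,2)$, then $$\sigma<\frac{a\log b}{2\log a}.$$ If $(a,b)=(3,2)$, then $\sigma=1$.
   Context: $p^g\,\|\,n$ means $p^g\mid n$ and $p^{g+1}\nmid n$. -}

module Defs where

open import Data.Nat using (ℕ; suc; _+_; _*_; _∸_; _^_; _≤_; _<_; _⊔_)
open import Data.Nat.Divisibility using (_∣_; _∣?_)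
open import Data.Nat.Primality using (Prime; prime?)
open import Data.List using (List; upTo; filter; map)
open import Data.Nat.ListAction using (product)
open import Data.Product using (_×_; ∃; ∃-syntax)
open import Data.Sum using (_⊎_)
open import Relation.Nullary using (¬_)
open import Relation.Nullary.Decidable using (_×-dec_)
open import Relation.Binary.PropositionalEquality using (_≡_)

ExactPower : ℕ → ℕ → ℕ → Set
ExactPower p g m = (p ^ g ∣ m) × ¬ (p ^ suc g ∣ m)

Good : ℕ → ℕ → ℕ → Set
Good b p n = ∃[ k ] (1 ≤ k × ((b ^ n ≡ k * p + 1) ⊎ (k * p ≡ b ^ n + 1)))

LeastGood : ℕ → ℕ → ℕ → Set
LeastGood b p n = 1 ≤ n × Good b p n × (∀ m → 1 ≤ m → m < n → ¬ Good b p m)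

SigmaExp : ℕ → ℕ → ℕ → Set
SigmaExp b p g =
  ∃[ n ] (LeastGood b p n ×
    ∃[ gp ] ∃[ gm ] (ExactPower p gp (b ^ n + 1) × ExactPower p gm (b ^ n ∸ 1)
                     × g ≡ gp ⊔ gm))

primeDivisors : ℕ → List ℕ
primeDivisors a = filter (λ p → prime? p ×-dec (p ∣? a)) (upTo (suc a))

-- ∏_i p_i ^ G(p_i) over the distinct primes p_i dividing a
-- (so that σ = log (sigmaProd a G) / log a)
sigmaProd : ℕ → (ℕ → ℕ) → ℕ
sigmaProd a G = product (map (λ p → p ^ G p) (primeDivisors a))

{-# OPTIONS --safe #-}
module Submission where

-- Write Fₚ = p ^ gₚ, so that σ log a = Σ log Fₚ.  For an odd prime p = 2m + 1 not dividing b,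
-- two of b⁰, …, bᵐ agree up to sign modulo p (pigeonhole), so the least n with bⁿ ≡ ±1 is at
-- most m and Fₚ ≤ bᵐ + 1, whence Fₚ² < bᵖ unless (p, b) = (3, 2); for p = 2 one gets
-- F₂ ≤ b + 1 < b^(3/2).  Over the prime divisors h < p₂ < ⋯ of a only the smallest needs the
-- weaker exponent h + 1, and h + 1 + Σ pᵢ ≤ h ∏ pᵢ ≤ a unless a = h is itself prime.
-- For (a, b) = (3, 2), n = 1 and 3 ∥ 2 + 1, so σ = 1.

open import Defs
open import Data.Nat using (ℕ; _^_; _*_; _<_)
open import Data.Nat.Coprimality using (Coprime)
open import Data.Nat.Primality using (Prime)
open import Data.Nat.Divisibility using (_∣_)
open import Data.Product using (_×_)
open import Relation.Nullary using (¬_)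
open import Relation.Binary.PropositionalEquality using (_≡_)

open import Data.Nat
open import Data.Nat.Properties
open import Data.Nat.DivMod
open import Data.Nat.Divisibility
open import Data.Nat.Primality
open import Data.Nat.Primality.Factorisation using (factorise; factorisationHasAllPrimeFactors)
open import Data.Nat.ListAction using (sum; product)
open import Data.Nat.ListAction.Properties using (∈⇒≤product)
open import Data.Nat.Tactic.RingSolver using (solve-∀)
open import Data.Fin using (Fin; toℕ; fromℕ<)
import Data.Fin.Properties as Fin
open import Data.List using ([]; _∷_; map; upTo)
open import Data.List.Membership.Propositional using (_∈_)
open import Data.List.Relation.Unary.Any using (here)
open import Data.List.Membership.Propositional.Properties using (∈-filter⁺; ∈-upTo⁺)
open import Data.List.Relation.Unary.All as All using (All; []; _∷_)
open import Data.List.Relation.Unary.All.Properties using (all-filter)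
open import Data.List.Relation.Unary.AllPairs using (AllPairs; []; _∷_)
import Data.List.Relation.Unary.AllPairs.Properties as AllPairs
open import Data.Product using (∃-syntax; _,_; proj₁)
open import Data.Sum using (_⊎_; inj₁; inj₂; [_,_]′)
open import Function using (id)
open import Relation.Nullary using (yes; no; contradiction)
open import Relation.Nullary.Decidable using (_×-dec_; toWitness)
open import Relation.Unary using (Decidable)
open import Relation.Binary.PropositionalEquality
  using (_≢_; refl; sym; trans; cong; cong₂; subst; module ≡-Reasoning)

suc-square<*square : ∀ {b x} → 2 ≤ b → 3 ≤ x → suc x * suc x < b * (x * x)
suc-square<*square {suc (suc c)} {suc (suc (suc k))} (s≤s (s≤s _)) (s≤s (s≤s (s≤s _))) =
  <-≤-trans (m<m+n _ z<s) (≤-reflexive (sym (expand c k)))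
  where
  expand : ∀ c k → (2 + c) * ((3 + k) * (3 + k))
                 ≡ (4 + k) * (4 + k) + suc (1 + 4 * k + k * k + c * ((3 + k) * (3 + k)))
  expand = solve-∀

suc-square<cube : ∀ {b} → 3 ≤ b → suc b * suc b < b ^ 3
suc-square<cube {suc (suc (suc k))} (s≤s (s≤s (s≤s _))) =
  <-≤-trans (m<m+n _ z<s) (≤-reflexive (sym (expand k)))
  where
  expand : ∀ k → (3 + k) * ((3 + k) * ((3 + k) * 1))
               ≡ (4 + k) * (4 + k) + suc (10 + 19 * k + 8 * (k * k) + k * k * k)
  expand = solve-∀

+≤* : ∀ {m n} → 2 ≤ m → 2 ≤ n → m + n ≤ m * n
+≤* {suc (suc i)} {suc (suc j)} (s≤s (s≤s _)) (s≤s (s≤s _)) =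
  ≤-trans (m≤m+n _ _) (≤-reflexive (sym (expand i j)))
  where
  expand : ∀ i j → (2 + i) * (2 + j) ≡ (2 + i) + (2 + j) + (i + j + i * j)
  expand = solve-∀

suc[+]≤* : ∀ {m n} → 2 ≤ m → 3 ≤ n → suc (m + n) ≤ m * n
suc[+]≤* {suc (suc i)} {suc (suc (suc j))} (s≤s (s≤s _)) (s≤s (s≤s (s≤s _))) =
  ≤-trans (m≤m+n _ _) (≤-reflexive (sym (expand i j)))
  where
  expand : ∀ i j → (2 + i) * (3 + j) ≡ suc ((2 + i) + (3 + j)) + (i + i + j + i * j)
  expand = solve-∀

n>1⇒nonZero : ∀ {n} → 1 < n → NonZero n
n>1⇒nonZero 1<n = >-nonZero (<-trans z<s 1<n)

2≤^ : ∀ {b n} → 2 ≤ b → 1 ≤ n → 2 ≤ b ^ n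
2≤^ {b} {suc n} 2≤b _ = ≤-trans 2≤b (m≤m*n b (b ^ n) {{m^n≢0 b n {{n>1⇒nonZero 2≤b}}}})

3≤^ : ∀ {b n} → 2 ≤ b → 1 ≤ n → ¬ (n ≡ 1 × b ≡ 2) → 3 ≤ b ^ n
3≤^ {b} {1} 2≤b _ ¬[1,2] =
  subst (3 ≤_) (sym (*-identityʳ b)) (≤∧≢⇒< 2≤b (λ 2≡b → ¬[1,2] (refl , sym 2≡b)))
3≤^ {b} {suc (suc n)} 2≤b _ _ =
  ≤-trans (n≤1+n 3) (≤-trans (^-monoʳ-≤ 2 {2} {2 + n} (s≤s (s≤s z≤n))) (^-monoˡ-≤ (2 + n) 2≤b))

^-split : ∀ b {i j} → i ≤ j → b ^ j ≡ b ^ i * b ^ (j ∸ i)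
^-split b {i} {j} i≤j = trans (cong (b ^_) (sym (m+[n∸m]≡n i≤j))) (^-distribˡ-+-* b i (j ∸ i))

odd⇒≡[n/2]*2+1 : ∀ {n} → ¬ 2 ∣ n → n ≡ n / 2 * 2 + 1
odd⇒≡[n/2]*2+1 {n} 2∤n with n % 2 in n%2≡r | m%n<n n 2
... | 0 | _ = contradiction (m%n≡0⇒n∣m n 2 n%2≡r) 2∤n
... | 1 | _ = trans (m≡m%n+[m/n]*n n 2) (trans (cong (_+ n / 2 * 2) n%2≡r) (+-comm 1 _))
... | suc (suc _) | s≤s (s≤s ())

prime≥2 : ∀ {p} → Prime p → 2 ≤ p
prime≥2 {p} p-prime = nonTrivial⇒n>1 p {{prime⇒nonTrivial p-prime}}

prime-parity : ∀ {p} → Prime p → p ≡ 2 ⊎ ∃[ m ] (1 ≤ m × p ≡ suc (m + m))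
prime-parity {p} p-prime with 2 ∣? p
... | yes 2∣p = inj₁ ([ (λ ()) , sym ]′ (prime⇒irreducible p-prime 2∣p))
... | no 2∤p =
  inj₂ (p / 2 , m≥n⇒m/n>0 (prime≥2 p-prime) , trans (odd⇒≡[n/2]*2+1 2∤p) (double (p / 2)))
  where
  double : ∀ m → m * 2 + 1 ≡ suc (m + m)
  double = solve-∀

%≡%⇒∣∸ : ∀ m n p .{{_ : NonZero p}} → m % p ≡ n % p → p ∣ n ∸ m
%≡%⇒∣∸ m n p eq = divides (n / p ∸ m / p) (begin
  n ∸ m                                   ≡⟨ cong₂ _∸_ (m≡m%n+[m/n]*n n p) (m≡m%n+[m/n]*n m p) ⟩
  (n % p + n / p * p) ∸ (m % p + m / p * p) ≡⟨ cong (λ r → (n % p + n / p * p) ∸ (r + m / p * p)) eq ⟩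
  (n % p + n / p * p) ∸ (n % p + m / p * p) ≡⟨ [m+n]∸[m+o]≡n∸o (n % p) _ _ ⟩
  n / p * p ∸ m / p * p                   ≡⟨ *-distribʳ-∸ p (n / p) (m / p) ⟨
  (n / p ∸ m / p) * p                     ∎)
  where open ≡-Reasoning

%+%≡⇒∣+ : ∀ m n p .{{_ : NonZero p}} → m % p + n % p ≡ p → p ∣ m + n
%+%≡⇒∣+ m n p eq = m%n≡0⇒n∣m (m + n) p (begin
  (m + n) % p         ≡⟨ %-distribˡ-+ m n p ⟩
  (m % p + n % p) % p ≡⟨ cong (_% p) eq ⟩
  p % p               ≡⟨ n%n≡0 p ⟩
  0                   ∎)
  where open ≡-Reasoning

prime∤⇒∤^ : ∀ {p b} → Prime p → ¬ p ∣ b → ∀ n → ¬ p ∣ b ^ n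
prime∤⇒∤^ p-prime p∤b zero p∣1 = ¬prime[1] (subst Prime (∣1⇒≡1 p∣1) p-prime)
prime∤⇒∤^ p-prime p∤b (suc n) p∣bⁿ⁺¹ =
  [ p∤b , prime∤⇒∤^ p-prime p∤b n ]′ (euclidsLemma _ _ p-prime p∣bⁿ⁺¹)

prime∤-cancelˡ : ∀ {p m n} → Prime p → ¬ p ∣ m → p ∣ m * n → p ∣ n
prime∤-cancelˡ p-prime p∤m p∣mn =
  [ (λ p∣m → contradiction p∣m p∤m) , id ]′ (euclidsLemma _ _ p-prime p∣mn)

exactPower⇒≤ : ∀ {p g m} → ExactPower p g m → p ^ g ≤ m
exactPower⇒≤ {p} {g} {zero} (_ , p^g+1∤0) = contradiction ((p ^ suc g) ∣0) p^g+1∤0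
exactPower⇒≤ {m = suc _} (p^g∣m , _) = ∣⇒≤ p^g∣m

exactPower-^ : ∀ {p g k} → 2 ≤ p → ExactPower p g (p ^ k) → g ≡ k
exactPower-^ {p} {g} {k} 2≤p (p^g∣p^k , p^g+1∤p^k) = ≤-antisym (≮⇒≥ k≮g) (≮⇒≥ g≮k)
  where
  instance
    p≢0 : NonZero p
    p≢0 = n>1⇒nonZero 2≤p
  k≮g : ¬ k < g
  k≮g k<g = <⇒≱ (^-monoʳ-< p 2≤p k<g) (∣⇒≤ {{m^n≢0 p k}} p^g∣p^k)
  g≮k : ¬ g < k
  g≮k g<k = p^g+1∤p^k (divides (p ^ (k ∸ suc g)) (trans (^-split p g<k) (*-comm (p ^ suc g) _)))

∣+1⇒good : ∀ {b p n} → p ∣ b ^ n + 1 → Good b p n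
∣+1⇒good {b} {n = n} (divides zero bⁿ+1≡0) = contradiction (trans (+-comm 1 (b ^ n)) bⁿ+1≡0) 1+n≢0
∣+1⇒good (divides (suc q) bⁿ+1≡kp) = suc q , s≤s z≤n , inj₂ (sym bⁿ+1≡kp)

∣∸1⇒good : ∀ {b p n} → 2 ≤ b ^ n → p ∣ b ^ n ∸ 1 → Good b p n
∣∸1⇒good 2≤bⁿ (divides zero bⁿ∸1≡0) = contradiction (sym bⁿ∸1≡0) (<⇒≢ (m<n⇒0<n∸m 2≤bⁿ))
∣∸1⇒good {b} {p} {n} 2≤bⁿ (divides (suc q) bⁿ∸1≡kp) = suc q , s≤s z≤n , inj₁ (begin
  b ^ n         ≡⟨ m∸n+n≡m (<⇒≤ 2≤bⁿ) ⟨
  b ^ n ∸ 1 + 1 ≡⟨ cong (_+ 1) bⁿ∸1≡kp ⟩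
  suc q * p + 1 ∎)
  where open ≡-Reasoning

∣+⇒good : ∀ {b p i j} → Prime p → ¬ p ∣ b → i ≤ j → p ∣ b ^ i + b ^ j → Good b p (j ∸ i)
∣+⇒good {b} {p} {i} {j} p-prime p∤b i≤j p∣sum =
  ∣+1⇒good {b} {p} {j ∸ i}
    (prime∤-cancelˡ p-prime (prime∤⇒∤^ p-prime p∤b i) (subst (p ∣_) factor p∣sum))
  where
  open ≡-Reasoning
  factor : b ^ i + b ^ j ≡ b ^ i * (b ^ (j ∸ i) + 1)
  factor = begin
    b ^ i + b ^ j                 ≡⟨ cong (b ^ i +_) (^-split b i≤j) ⟩
    b ^ i + b ^ i * b ^ (j ∸ i)   ≡⟨ +-comm (b ^ i) _ ⟩
    b ^ i * b ^ (j ∸ i) + b ^ i   ≡⟨ cong (b ^ i * b ^ (j ∸ i) +_) (*-identityʳ (b ^ i)) ⟨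
    b ^ i * b ^ (j ∸ i) + b ^ i * 1 ≡⟨ *-distribˡ-+ (b ^ i) _ 1 ⟨
    b ^ i * (b ^ (j ∸ i) + 1)     ∎

∣∸⇒good : ∀ {b p i j} → Prime p → ¬ p ∣ b → 2 ≤ b → i < j → p ∣ b ^ j ∸ b ^ i → Good b p (j ∸ i)
∣∸⇒good {b} {p} {i} {j} p-prime p∤b 2≤b i<j p∣diff =
  ∣∸1⇒good {b} {p} {j ∸ i} (2≤^ 2≤b (m<n⇒0<n∸m i<j))
    (prime∤-cancelˡ p-prime (prime∤⇒∤^ p-prime p∤b i) (subst (p ∣_) factor p∣diff))
  where
  open ≡-Reasoning
  factor : b ^ j ∸ b ^ i ≡ b ^ i * (b ^ (j ∸ i) ∸ 1)
  factor = begin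
    b ^ j ∸ b ^ i                 ≡⟨ cong₂ _∸_ (^-split b (<⇒≤ i<j)) (sym (*-identityʳ (b ^ i))) ⟩
    b ^ i * b ^ (j ∸ i) ∸ b ^ i * 1 ≡⟨ *-distribˡ-∸ (b ^ i) (b ^ (j ∸ i)) 1 ⟨
    b ^ i * (b ^ (j ∸ i) ∸ 1)     ∎

-- A nonzero residue r modulo 2m+1 and its negative 2m+1−r share one class in {0, …, m−1}.
signClass : ℕ → ℕ → ℕ
signClass m r = (r ∸ 1) ⊓ (m + m ∸ r)

signClass<m : ∀ {m r} → 1 ≤ r → r ≤ m + m → signClass m r < m
signClass<m {m} {suc r} _ r<2m with suc r ≤? m
... | yes r<m = <-≤-trans (m<n⇒m⊓o<n _ (n<1+n r)) r<m
... | no r≮m = ≤-<-trans (m⊓n≤n r _) (begin-strict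
  m + m ∸ suc r <⟨ ∸-monoʳ-< (≰⇒> r≮m) r<2m ⟩
  m + m ∸ m     ≡⟨ m+n∸m≡n m m ⟩
  m             ∎)
  where open ≤-Reasoning

≡∸⇒+≡ : ∀ {m n o} → n ≤ o → m ≡ o ∸ n → m + n ≡ o
≡∸⇒+≡ n≤o refl = m∸n+n≡m n≤o

signClass-≡ : ∀ {m r s} → 1 ≤ r → r ≤ m + m → 1 ≤ s → s ≤ m + m →
              signClass m r ≡ signClass m s → r ≡ s ⊎ r + s ≡ suc (m + m)
signClass-≡ {m} {suc r} {suc s} _ r<2m _ s<2m eq
  with ⊓-sel r (m + m ∸ suc r) | ⊓-sel s (m + m ∸ suc s)
... | inj₁ eʳ | inj₁ eˢ = inj₁ (cong suc (trans (sym eʳ) (trans eq eˢ)))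
... | inj₂ eʳ | inj₂ eˢ = inj₁ (∸-cancelˡ-≡ r<2m s<2m (trans (sym eʳ) (trans eq eˢ)))
... | inj₁ eʳ | inj₂ eˢ = inj₂ (cong suc (≡∸⇒+≡ s<2m (trans (sym eʳ) (trans eq eˢ))))
... | inj₂ eʳ | inj₁ eˢ =
  inj₂ (trans (+-comm (suc r) (suc s)) (cong suc (≡∸⇒+≡ r<2m (trans (sym eˢ) (trans (sym eq) eʳ)))))

-- Pigeonhole: the m+1 powers b⁰, …, bᵐ fall into m sign classes modulo p = 2m+1.
module _ {b m : ℕ} (2≤b : 2 ≤ b) (p-prime : Prime (suc (m + m))) (p∤b : ¬ suc (m + m) ∣ b) where

  private
    p : ℕ
    p = suc (m + m)

    residue : ℕ → ℕ
    residue k = b ^ k % p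

    1≤residue : ∀ k → 1 ≤ residue k
    1≤residue k = n≢0⇒n>0 λ r≡0 → prime∤⇒∤^ p-prime p∤b k (m%n≡0⇒n∣m _ p r≡0)

    residue≤2m : ∀ k → residue k ≤ m + m
    residue≤2m k = s≤s⁻¹ (m%n<n (b ^ k) p)

    class : Fin (suc m) → Fin m
    class k = fromℕ< (signClass<m (1≤residue (toℕ k)) (residue≤2m (toℕ k)))

    good-of-clash : ∀ i j → i < j → residue i ≡ residue j ⊎ residue i + residue j ≡ p →
                    Good b p (j ∸ i)
    good-of-clash i j i<j (inj₁ same) =
      ∣∸⇒good {b} {p} {i} {j} p-prime p∤b 2≤b i<j (%≡%⇒∣∸ (b ^ i) (b ^ j) p same)
    good-of-clash i j i<j (inj₂ opposite) =
      ∣+⇒good {b} {p} {i} {j} p-prime p∤b (<⇒≤ i<j) (%+%≡⇒∣+ (b ^ i) (b ^ j) p opposite)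

  good≤half : ∃[ d ] (1 ≤ d × d ≤ m × Good b p d)
  good≤half with i , j , i<j , classᵢ≡classⱼ ← Fin.pigeonhole (n<1+n m) class =
    toℕ j ∸ toℕ i , m<n⇒0<n∸m i<j , ≤-trans (m∸n≤m (toℕ j) (toℕ i)) (s≤s⁻¹ (Fin.toℕ<n j)) ,
    good-of-clash (toℕ i) (toℕ j) i<j (signClass-≡ {m} (1≤residue (toℕ i)) (residue≤2m (toℕ i))
      (1≤residue (toℕ j)) (residue≤2m (toℕ j))
      (trans (sym (Fin.toℕ-fromℕ< _)) (trans (cong toℕ classᵢ≡classⱼ) (Fin.toℕ-fromℕ< _))))

good[2,1] : ∀ {b} → 2 ≤ b → ¬ 2 ∣ b → Good b 2 1
good[2,1] {b} 2≤b 2∤b = b / 2 , m≥n⇒m/n>0 2≤b , inj₁ (trans (*-identityʳ b) (odd⇒≡[n/2]*2+1 2∤b))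

leastGood≤ : ∀ {b p n d} → LeastGood b p n → 1 ≤ d → Good b p d → n ≤ d
leastGood≤ (_ , _ , minimal) 1≤d good = ≮⇒≥ (λ d<n → minimal _ 1≤d d<n good)

sigmaExp≤ : ∀ {b p g d} → 1 ≤ b → SigmaExp b p g → 1 ≤ d → Good b p d → p ^ g ≤ suc (b ^ d)
sigmaExp≤ {b} {p} 1≤b (n , least , gp , gm , plus , minus , refl) 1≤d good =
  ≤-trans p^g≤ (s≤s (^-monoʳ-≤ b {{>-nonZero 1≤b}} (leastGood≤ least 1≤d good)))
  where
  p^g≤ : p ^ (gp ⊔ gm) ≤ suc (b ^ n)
  p^g≤ with ⊔-sel gp gm
  ... | inj₁ gp⊔gm≡gp rewrite gp⊔gm≡gp =
    ≤-trans (exactPower⇒≤ {p} {gp} plus) (≤-reflexive (+-comm (b ^ n) 1))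
  ... | inj₂ gp⊔gm≡gm rewrite gp⊔gm≡gm =
    ≤-trans (exactPower⇒≤ {p} {gm} minus) (≤-trans (m∸n≤m (b ^ n) 1) (n≤1+n _))

sigmaExp-odd≤ : ∀ {b m g} → 2 ≤ b → Prime (suc (m + m)) → ¬ suc (m + m) ∣ b →
                SigmaExp b (suc (m + m)) g → suc (m + m) ^ g ≤ suc (b ^ m)
sigmaExp-odd≤ {b} {m} 2≤b p-prime p∤b σ
  with d , 1≤d , d≤m , good ← good≤half {b} {m} 2≤b p-prime p∤b =
  ≤-trans (sigmaExp≤ (<⇒≤ 2≤b) σ 1≤d good) (s≤s (^-monoʳ-≤ b {{n>1⇒nonZero 2≤b}} d≤m))

square-sigmaExp-odd< : ∀ {b m g} → 2 ≤ b → 1 ≤ m → ¬ (m ≡ 1 × b ≡ 2) →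
                       Prime (suc (m + m)) → ¬ suc (m + m) ∣ b → SigmaExp b (suc (m + m)) g →
                       suc (m + m) ^ g * suc (m + m) ^ g < b ^ suc (m + m)
square-sigmaExp-odd< {b} {m} {g} 2≤b 1≤m ¬[1,2] p-prime p∤b σ = begin-strict
  p ^ g * p ^ g           ≤⟨ *-mono-≤ p^g≤ p^g≤ ⟩
  suc (b ^ m) * suc (b ^ m) <⟨ suc-square<*square 2≤b (3≤^ 2≤b 1≤m ¬[1,2]) ⟩
  b * (b ^ m * b ^ m)     ≡⟨ cong (b *_) (^-distribˡ-+-* b m m) ⟨
  b ^ suc (m + m)         ∎
  where
  open ≤-Reasoning
  p = suc (m + m)
  p^g≤ = sigmaExp-odd≤ {m = m} 2≤b p-prime p∤b σ

square-sigmaExp<^ : ∀ {b p g} → 2 ≤ b → Prime p → ¬ p ∣ b → 3 ≤ p → ¬ (p ≡ 3 × b ≡ 2) →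
                    SigmaExp b p g → p ^ g * p ^ g < b ^ p
square-sigmaExp<^ 2≤b p-prime p∤b 3≤p ¬[3,2] σ with prime-parity p-prime
... | inj₁ refl = contradiction 3≤p λ { (s≤s (s≤s ())) }
... | inj₂ (m , 1≤m , refl) = square-sigmaExp-odd< {m = m} 2≤b 1≤m
  (λ (m≡1 , b≡2) → ¬[3,2] (cong (λ k → suc (k + k)) m≡1 , b≡2)) p-prime p∤b σ

square-sigmaExp<^suc : ∀ {b p g} → 2 ≤ b → Prime p → ¬ p ∣ b → SigmaExp b p g →
                       p ^ g * p ^ g < b ^ suc p
square-sigmaExp<^suc {b} {g = g} 2≤b p-prime p∤b σ with prime-parity p-prime
... | inj₁ refl = ≤-<-trans (*-mono-≤ 2^g≤ 2^g≤) (suc-square<cube 3≤b)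
  where
  3≤b : 3 ≤ b
  3≤b = ≤∧≢⇒< 2≤b (λ 2≡b → p∤b (subst (2 ∣_) 2≡b ∣-refl))
  2^g≤ : 2 ^ g ≤ suc b
  2^g≤ = ≤-trans (sigmaExp≤ (<⇒≤ 2≤b) σ ≤-refl (good[2,1] 2≤b p∤b))
                 (s≤s (≤-reflexive (^-identityʳ b)))
... | inj₂ (m , 1≤m , refl) with m ≟ 1 ×-dec b ≟ 2
...   | no ¬[1,2] = <-≤-trans (square-sigmaExp-odd< {m = m} 2≤b 1≤m ¬[1,2] p-prime p∤b σ)
                               (^-monoʳ-≤ b {{n>1⇒nonZero 2≤b}} (n≤1+n (suc (m + m))))
...   | yes (refl , refl) = ≤-<-trans (*-mono-≤ 3^g≤3 3^g≤3) (<ᵇ⇒< 9 16 _)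
  where
  3^g≤3 : 3 ^ g ≤ 3
  3^g≤3 = sigmaExp-odd≤ {m = 1} 2≤b p-prime p∤b σ

square-product≤ : ∀ {b} (F : ℕ → ℕ) xs → All (λ x → F x * F x ≤ b ^ x) xs →
                  product (map F xs) * product (map F xs) ≤ b ^ sum xs
square-product≤ F [] [] = ≤-refl
square-product≤ {b} F (x ∷ xs) (Fx²≤ ∷ bounds) = begin
  (F x * Π) * (F x * Π) ≡⟨ [m*n]*[o*p]≡[m*o]*[n*p] (F x) Π (F x) Π ⟩
  (F x * F x) * (Π * Π) ≤⟨ *-mono-≤ Fx²≤ (square-product≤ F xs bounds) ⟩
  b ^ x * b ^ sum xs    ≡⟨ ^-distribˡ-+-* b x (sum xs) ⟨
  b ^ (x + sum xs)      ∎
  where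
  open ≤-Reasoning
  Π = product (map F xs)

square-product< : ∀ {b e x} (F : ℕ → ℕ) xs → 1 ≤ b → F x * F x < b ^ e →
                  All (λ y → F y * F y ≤ b ^ y) xs →
                  product (map F (x ∷ xs)) * product (map F (x ∷ xs)) < b ^ (e + sum xs)
square-product< {b} {e} {x} F xs 1≤b Fx²< bounds = begin-strict
  (F x * Π) * (F x * Π) ≡⟨ [m*n]*[o*p]≡[m*o]*[n*p] (F x) Π (F x) Π ⟩
  (F x * F x) * (Π * Π) ≤⟨ *-monoʳ-≤ (F x * F x) (square-product≤ F xs bounds) ⟩
  (F x * F x) * b ^ sum xs <⟨ *-monoˡ-< (b ^ sum xs) {{m^n≢0 b (sum xs) {{>-nonZero 1≤b}}}} Fx²< ⟩
  b ^ e * b ^ sum xs    ≡⟨ ^-distribˡ-+-* b e (sum xs) ⟨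
  b ^ (e + sum xs)      ∎
  where
  open ≤-Reasoning
  Π = product (map F xs)

sum≤product : ∀ xs → All (2 ≤_) xs → sum xs ≤ product xs
sum≤product [] [] = z≤n
sum≤product (x ∷ []) (_ ∷ []) = ≤-reflexive (trans (+-identityʳ x) (sym (*-identityʳ x)))
sum≤product (x ∷ y ∷ xs) (2≤x ∷ 2≤ys@(2≤y ∷ _)) =
  ≤-trans (+-monoʳ-≤ x (sum≤product (y ∷ xs) 2≤ys))
          (+≤* 2≤x (≤-trans 2≤y (∈⇒≤product (All.map n>1⇒nonZero 2≤ys) (here refl))))

suc[+sum]≤*product : ∀ {h} xs → xs ≢ [] → 2 ≤ h → All (h <_) xs → suc (h + sum xs) ≤ h * product xs
suc[+sum]≤*product [] []≢[] _ _ = contradiction refl []≢[]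
suc[+sum]≤*product {h} (y ∷ xs) _ 2≤h h<ys@(h<y ∷ _) = begin
  suc (h + sum (y ∷ xs))     ≤⟨ s≤s (+-monoʳ-≤ h (sum≤product (y ∷ xs) 2≤ys)) ⟩
  suc (h + product (y ∷ xs)) ≤⟨ suc[+]≤* 2≤h (≤-trans (s≤s 2≤h) (≤-trans h<y y≤Π)) ⟩
  h * product (y ∷ xs)       ∎
  where
  open ≤-Reasoning
  2≤ys : All (2 ≤_) (y ∷ xs)
  2≤ys = All.map (λ h<z → ≤-trans 2≤h (<⇒≤ h<z)) h<ys
  y≤Π : y ≤ product (y ∷ xs)
  y≤Π = ∈⇒≤product (All.map n>1⇒nonZero 2≤ys) (here refl)

PrimeDivisor : ℕ → ℕ → Set
PrimeDivisor a p = Prime p × p ∣ a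

primeDivisor? : ∀ a → Decidable (PrimeDivisor a)
primeDivisor? a p = prime? p ×-dec (p ∣? a)

product-primeDivisors∣ : ∀ {a} xs → AllPairs _<_ xs → All (PrimeDivisor a) xs → product xs ∣ a
product-primeDivisors∣ [] [] [] = 1∣ _
product-primeDivisors∣ (x ∷ xs) (x<xs ∷ sorted) ((x-prime , x∣a) ∷ divisors)
  with divides q a≡qΠ ← product-primeDivisors∣ xs sorted divisors
  with euclidsLemma q (product xs) x-prime (subst (x ∣_) a≡qΠ x∣a)
... | inj₁ (divides r q≡rx) =
  divides r (trans a≡qΠ (trans (cong (_* product xs) q≡rx) (*-assoc r x _)))
... | inj₂ x∣Π = contradiction (All.lookup x<xs x∈xs) (<-irrefl refl)
  where
  x∈xs = factorisationHasAllPrimeFactors x-prime x∣Π (All.map proj₁ divisors)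

exponent-budget : ∀ {a h} xs → 0 < a → AllPairs _<_ (h ∷ xs) → All (PrimeDivisor a) (h ∷ xs) →
                  suc h + sum xs ≤ a ⊎ (xs ≡ [] × h ≡ a)
exponent-budget {a} [] 0<a _ ((_ , h∣a) ∷ []) with m≤n⇒m<n∨m≡n (∣⇒≤ {{>-nonZero 0<a}} h∣a)
... | inj₁ h<a = inj₁ (subst (_≤ a) (sym (+-identityʳ _)) h<a)
... | inj₂ h≡a = inj₂ (refl , h≡a)
exponent-budget {h = h} (y ∷ xs) 0<a sorted@(h<ys ∷ _) divisors@((h-prime , _) ∷ _) =
  inj₁ (≤-trans (suc[+sum]≤*product (y ∷ xs) (λ ()) (prime≥2 h-prime) h<ys)
                (∣⇒≤ {{>-nonZero 0<a}} (product-primeDivisors∣ (h ∷ y ∷ xs) sorted divisors)))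

primeDivisors-prime∣ : ∀ a → All (PrimeDivisor a) (primeDivisors a)
primeDivisors-prime∣ a = all-filter (primeDivisor? a) (upTo (suc a))

primeDivisors-sorted : ∀ a → AllPairs _<_ (primeDivisors a)
primeDivisors-sorted a =
  AllPairs.filter⁺ (primeDivisor? a) (AllPairs.applyUpTo⁺₁ id (suc a) (λ i<j _ → i<j))

primeDivisors≢[] : ∀ {a} → 1 < a → primeDivisors a ≢ []
primeDivisors≢[] {a} 1<a with factorise a {{n>1⇒nonZero 1<a}}
... | record { factors = [] ; isFactorisation = a≡1 } = λ _ → <⇒≢ 1<a (sym a≡1)
... | record { factors = q ∷ qs ; isFactorisation = a≡qΠ ; factorsPrime = q-prime ∷ _ } =
  λ ps≡[] → contradiction (subst (q ∈_) ps≡[] q∈ps) λ ()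
  where
  q∣a : q ∣ a
  q∣a = subst (q ∣_) (sym a≡qΠ) (m∣m*n (product qs))
  q∈ps : q ∈ primeDivisors a
  q∈ps = ∈-filter⁺ (primeDivisor? a) (∈-upTo⁺ (s≤s (∣⇒≤ {{n>1⇒nonZero 1<a}} q∣a))) (q-prime , q∣a)

module _ {a b : ℕ} (1<b : 1 < b) (coprime : Coprime a b) (G : ℕ → ℕ)
         (sigmaExp : ∀ p → Prime p → p ∣ a → SigmaExp b p (G p)) where

  private
    F : ℕ → ℕ
    F p = p ^ G p

    ∤b : ∀ {p} → PrimeDivisor a p → ¬ p ∣ b
    ∤b (p-prime , p∣a) p∣b = ¬prime[1] (subst Prime (coprime (p∣a , p∣b)) p-prime)

    -- The only exceptional prime (p, b) = (3, 2) cannot occur above the smallest prime divisor h,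
    -- since then h = 2 would divide both a and b.
    square-F≤ : ∀ {h x} → PrimeDivisor a h → h < x → PrimeDivisor a x → F x * F x ≤ b ^ x
    square-F≤ {h} {x} h∣a@(h-prime , _) h<x x∣a@(x-prime , x∣a') =
      <⇒≤ (square-sigmaExp<^ 1<b x-prime (∤b x∣a) 3≤x ¬[3,2] (sigmaExp x x-prime x∣a'))
      where
      3≤x : 3 ≤ x
      3≤x = ≤-trans (s≤s (prime≥2 h-prime)) h<x
      ¬[3,2] : ¬ (x ≡ 3 × b ≡ 2)
      ¬[3,2] (x≡3 , b≡2) = ∤b h∣a (subst (h ∣_) (sym b≡2) (subst (_∣ 2) (sym h≡2) ∣-refl))
        where
        h≡2 : h ≡ 2
        h≡2 = ≤-antisym (s≤s⁻¹ (subst (h <_) x≡3 h<x)) (prime≥2 h-prime)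

  square-sigmaProduct< : 2 < a → ¬ (a ≡ 3 × b ≡ 2) → ∀ xs → xs ≢ [] →
                         AllPairs _<_ xs → All (PrimeDivisor a) xs →
                         product (map F xs) * product (map F xs) < b ^ a
  square-sigmaProduct< _ _ [] []≢[] _ _ = contradiction refl []≢[]
  square-sigmaProduct< 2<a ¬[3,2] (h ∷ xs) _
                       sorted@(h<xs ∷ _) divisors@(h∣a@(h-prime , h∣a') ∷ xs∣a)
    with exponent-budget xs (<-trans z<s 2<a) sorted divisors
  ... | inj₁ budget =
    <-≤-trans (square-product< {e = suc h} F xs (<⇒≤ 1<b) head tail)
              (^-monoʳ-≤ b {{n>1⇒nonZero 1<b}} budget)
    where
    head : F h * F h < b ^ suc h
    head = square-sigmaExp<^suc 1<b h-prime (∤b h∣a) (sigmaExp h h-prime h∣a')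
    tail : All (λ x → F x * F x ≤ b ^ x) xs
    tail = All.zipWith (λ (h<x , x∣a) → square-F≤ h∣a h<x x∣a) (h<xs , xs∣a)
  ... | inj₂ (refl , h≡a) =
    <-≤-trans (square-product< {e = h} F [] (<⇒≤ 1<b) head [])
              (≤-reflexive (cong (b ^_) (trans (+-identityʳ h) h≡a)))
    where
    head : F h * F h < b ^ h
    head = square-sigmaExp<^ 1<b h-prime (∤b h∣a) (subst (2 <_) (sym h≡a) 2<a)
             (subst (λ n → ¬ (n ≡ 3 × b ≡ 2)) (sym h≡a) ¬[3,2]) (sigmaExp h h-prime h∣a')

sigmaExp[2,3] : ∀ {g} → SigmaExp 2 3 g → g ≡ 1
sigmaExp[2,3] (0 , (() , _) , _)
sigmaExp[2,3] (1 , _ , gp , gm , plus , minus , refl) =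
  cong₂ _⊔_ (exactPower-^ {3} {gp} {1} (s≤s (s≤s z≤n)) plus)
            (exactPower-^ {3} {gm} {0} (s≤s (s≤s z≤n)) minus)
sigmaExp[2,3] (suc (suc n) , least , _) =
  contradiction (leastGood≤ least ≤-refl (1 , ≤-refl , inj₂ refl)) λ { (s≤s ()) }

sigmaProd[3]≡3 : ∀ {a b} (G : ℕ → ℕ) → (∀ p → Prime p → p ∣ a → SigmaExp b p (G p)) →
                 a ≡ 3 → b ≡ 2 → sigmaProd a G ≡ a
sigmaProd[3]≡3 G sigmaExp refl refl =
  cong (λ g → 3 ^ g * 1) (sigmaExp[2,3] (sigmaExp 3 (toWitness {a? = prime? 3} _) ∣-refl))

lemma18 : (a b : ℕ) → 1 < a → 1 < b → Coprime a b →
          (G : ℕ → ℕ) → (∀ p → Prime p → p ∣ a → SigmaExp b p (G p)) →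
          ((2 < a → ¬ (a ≡ 3 × b ≡ 2) →
             sigmaProd a G * sigmaProd a G < b ^ a)
          × (a ≡ 3 → b ≡ 2 → sigmaProd a G ≡ a))
lemma18 a b 1<a 1<b coprime G sigmaExp = regular , sigmaProd[3]≡3 G sigmaExp
  where
  regular : 2 < a → ¬ (a ≡ 3 × b ≡ 2) → sigmaProd a G * sigmaProd a G < b ^ a
  regular 2<a ¬[3,2] = square-sigmaProduct< 1<b coprime G sigmaExp 2<a ¬[3,2]
    (primeDivisors a) (primeDivisors≢[] 1<a) (primeDivisors-sorted a) (primeDivisors-prime∣ a)
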